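{- Fix real numbers $0<\alpha<\beta<1$ such that $\beta<2\sqrt\alpha-\alpha$ (equivalently $(\alpha+\beta)^2<4\alpha$), and let $D=(d_1,\ldots,d_n)$ be an integer sequence with $\alpha<\frac{d_i}{n-1}<\beta$ for $i=1,\ldots,n$. Then for $$n>\max\Big\{\frac{\beta}{\alpha(1-\beta)},\ \frac{4(\beta-\alpha)}{4\alpha-(\alpha+\beta)^2}\Big\}+1$$ the polytope $\mathcal{P}(D)$ has a non-empty interior, i.e. contains a point $y=(\eta_{\{j,k\}})$ with $0<\eta_{\{j,k\}}<1$ for all $1\le j\ne k\le n$.
   Context: $\mathcal{P}(D)\subset\mathbb{R}^{\binom n2}$, with coordinates indexed by unordered pairs $\{j,k\}$, $1\le j\ne k\le n$, is the set of $x=(\xi_{\{j,k\}})$ with $\sum_{j:\,j\ne k}\xi_{\{j,k\}}=d_k$ for $k=1,\ldots,n$ and $0\le\xi_{\{j,k\}}\le1$.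
   Formalization: The parameters α and β are rational instead of real, and the coordinates of the interior point y are taken in the rationals. -}

module Defs where

open import Data.Nat using (ℕ; zero; suc)
open import Data.Fin using (Fin; zero; suc; _≟_)
open import Data.Integer using (ℤ)
open import Data.Rational using (ℚ; 0ℚ; 1ℚ; _+_; _≤_; _<_; _/_)
open import Data.Product using (_×_)
open import Relation.Nullary using (yes; no)
open import Relation.Binary.PropositionalEquality using (_≡_; _≢_)

Σℚ : ∀ {n} → (Fin n → ℚ) → ℚ
Σℚ {zero} f = 0ℚ
Σℚ {suc n} f = f zero + Σℚ (λ i → f (suc i))

offDiagSum : ∀ {n} → (Fin n → Fin n → ℚ) → Fin n → ℚ
offDiagSum x k = Σℚ (λ j → sel j)
  where
  sel : _ → ℚ
  sel j with j ≟ k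
  ... | yes _ = 0ℚ
  ... | no _  = x j k

-- A point of ℝ^{n choose 2} indexed by unordered pairs {j,k} is represented
-- as a symmetric function x : Fin n → Fin n → ℚ (diagonal values irrelevant).
Symmetric : ∀ {n} → (Fin n → Fin n → ℚ) → Set
Symmetric x = ∀ j k → x j k ≡ x k j

InPolytope : ∀ {n} → (Fin n → ℤ) → (Fin n → Fin n → ℚ) → Set
InPolytope D x =
  Symmetric x
  × (∀ k → offDiagSum x k ≡ D k / 1)
  × (∀ j k → j ≢ k → (0ℚ ≤ x j k × x j k ≤ 1ℚ))

InteriorPoint : ∀ {n} → (Fin n → ℤ) → (Fin n → Fin n → ℚ) → Set
InteriorPoint D y =
  InPolytope D y × (∀ j k → j ≢ k → (0ℚ < y j k × y j k < 1ℚ))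

{-# OPTIONS --safe #-}
-- Write dᵢ = δᵢ ν with ν = n - 1 and α < δᵢ < β. If ν (β - α) ≤ 1 the integers dᵢ are all
-- equal and the constant matrix δ₀ is an interior point. Otherwise give each vertex i,
-- independently, the type "high" with probability θᵢ = (δᵢ - α) / (β - α) and "low" otherwise.
-- For every assignment of types there is a symmetric matrix with entries in (0,1), depending
-- only on the types of the endpoints, in which high vertices have degree βν and low ones αν;
-- its expectation has degree θᵢ βν + (1 - θᵢ) αν = dᵢ at i and entries in (0,1). For k high
-- and l low vertices the three weights exist once x² - (1 + (α + β) ν) x + α ν (ν + 1) has no
-- real root, which is what the lower bound on n guarantees.
module Submission where

open import Defs
open import Level using (0ℓ)
open import Data.Empty using (⊥-elim)
open import Data.Bool using (Bool; true; false; not; if_then_else_)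
open import Data.Nat using (ℕ; zero; suc; _∸_)
open import Data.Nat as ℕ using ()
import Data.Nat.Properties as ℕₚ
open import Data.Fin using (Fin; zero; suc; _≟_)
open import Data.Vec.Functional using (Vector; _∷_; head; tail)
open import Function using (_∘_)
open import Data.Integer using (ℤ; +_)
import Data.Integer as ℤ
import Data.Integer.Properties as ℤₚ
open import Data.Rational
  using (ℚ; 0ℚ; 1ℚ; _+_; _-_; _*_; _<_; _≤_; _/_; _÷_; _⊔_; _⊓_; NonZero; 1/_; -_; toℚᵘ; >-nonZero; positive; nonNegative; nonPositive)
open import Data.Rational.Properties hiding (_≟_)
import Data.Rational.Properties as ℚₚ
import Data.Rational.Unnormalised as ℚᵘ
import Data.Rational.Unnormalised.Properties as ℚᵘₚ
open import Data.Product using (Σ; _×_; _,_; proj₁; proj₂)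
open import Data.Sum using (inj₁; inj₂)
open import Relation.Nullary using (yes; no)
open import Relation.Nullary.Decidable using (dec⇒maybe)
open import Relation.Binary.PropositionalEquality
open import Algebra.Properties.Group +-0-group using () renaming (∙-cancelˡ to +-cancelˡ-≡; ∙-cancelʳ to +-cancelʳ-≡)
import Data.Integer.Tactic.RingSolver as ℤ-Solver
open import Tactic.RingSolver using (solve-∀)
import Tactic.RingSolver.Core.AlmostCommutativeRing as ACR

ℚ-ring : ACR.AlmostCommutativeRing 0ℓ 0ℓ
ℚ-ring = ACR.fromCommutativeRing +-*-commutativeRing (λ q → dec⇒maybe (0ℚ ℚₚ.≟ q))

infix 4 _∈⟨0,1⟩
_∈⟨0,1⟩ : ℚ → Set
q ∈⟨0,1⟩ = 0ℚ < q × q < 1ℚ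

p<q⇒0<q-p : ∀ {p q} → p < q → 0ℚ < q - p
p<q⇒0<q-p {p} {q} p<q = subst (_< q - p) (+-inverseʳ p) (+-monoˡ-< (- p) p<q)

0<q-p⇒p<q : ∀ {p q} → 0ℚ < q - p → p < q
0<q-p⇒p<q {p} {q} 0<q-p = subst₂ _<_ (+-identityˡ p) (cancel q p) (+-monoˡ-< p 0<q-p)
  where
  cancel : ∀ q p → q - p + p ≡ q
  cancel = solve-∀ ℚ-ring

p≤q⇒0≤q-p : ∀ {p q} → p ≤ q → 0ℚ ≤ q - p
p≤q⇒0≤q-p {p} {q} p≤q = subst (_≤ q - p) (+-inverseʳ p) (+-monoˡ-≤ (- p) p≤q)

+-cancelʳ-< : ∀ {p q} r → p + r < q + r → p < q
+-cancelʳ-< {p} {q} r p+r<q+r = subst₂ _<_ (cancel p r) (cancel q r) (+-monoˡ-< (- r) p+r<q+r)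
  where
  cancel : ∀ p r → p + r - r ≡ p
  cancel = solve-∀ ℚ-ring

+-pos : ∀ {p q} → 0ℚ < p → 0ℚ < q → 0ℚ < p + q
+-pos {p} {q} 0<p 0<q = positive⁻¹ _ {{pos+pos⇒pos p {{positive 0<p}} q {{positive 0<q}}}}

+-pos-nonNeg : ∀ {p q} → 0ℚ < p → 0ℚ ≤ q → 0ℚ < p + q
+-pos-nonNeg {p} {q} 0<p 0≤q = positive⁻¹ _ {{pos+nonNeg⇒pos p {{positive 0<p}} q {{nonNegative 0≤q}}}}

*-pos : ∀ {p q} → 0ℚ < p → 0ℚ < q → 0ℚ < p * q
*-pos {p} {q} 0<p 0<q = positive⁻¹ _ {{pos*pos⇒pos p {{positive 0<p}} q {{positive 0<q}}}}

*-monoˡ-<′ : ∀ {p q} r → 0ℚ < r → p < q → p * r < q * r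
*-monoˡ-<′ r 0<r = *-monoˡ-<-pos r {{positive 0<r}}

*-cancelʳ-<′ : ∀ {p q} r → 0ℚ < r → p * r < q * r → p < q
*-cancelʳ-<′ r 0<r = *-cancelʳ-<-nonNeg r {{nonNegative (<⇒≤ 0<r)}}

0<p*q⇒0<q : ∀ {p q} → 0ℚ < p → 0ℚ < p * q → 0ℚ < q
0<p*q⇒0<q {p} {q} 0<p 0<pq = *-cancelʳ-<′ p 0<p (subst₂ _<_ (sym (*-zeroˡ p)) (*-comm p q) 0<pq)

square-nonNeg : ∀ p → 0ℚ ≤ p * p
square-nonNeg p with ≤-total 0ℚ p
... | inj₁ 0≤p = nonNegative⁻¹ _ {{nonNeg*nonNeg⇒nonNeg p {{nonNegative 0≤p}} p {{nonNegative 0≤p}}}}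
... | inj₂ p≤0 = nonNegative⁻¹ _ {{nonPos*nonPos⇒nonPos p {{nonPositive p≤0}} p {{nonPositive p≤0}}}}

-<⇒-< : ∀ a {b c} → a - b < c → a - c < b
-<⇒-< a {b} {c} a-b<c = 0<q-p⇒p<q (subst (0ℚ <_) (exchange a b c) (p<q⇒0<q-p a-b<c))
  where
  exchange : ∀ a b c → c - (a - b) ≡ b - (a - c)
  exchange = solve-∀ ℚ-ring

pos+≡⇒< : ∀ {x y z} → 0ℚ < x → x + y ≡ z → y < z
pos+≡⇒< {x} {y} 0<x x+y≡z = subst₂ _<_ (+-identityˡ y) x+y≡z (+-monoˡ-< y 0<x)

÷-*-cancel : ∀ p q .{{_ : NonZero q}} → (p ÷ q) * q ≡ p
÷-*-cancel p q = begin
  p * 1/ q * q    ≡⟨ *-assoc p (1/ q) q ⟩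
  p * (1/ q * q)  ≡⟨ cong (p *_) (*-inverseˡ q) ⟩
  p * 1ℚ          ≡⟨ *-identityʳ p ⟩
  p               ∎
  where open ≡-Reasoning

module _ {c} (0<c : 0ℚ < c) .{{_ : NonZero c}} where

  *<⇒<÷ : ∀ a {b} → b * c < a → b < a ÷ c
  *<⇒<÷ a {b} bc<a = *-cancelʳ-<′ c 0<c (subst (b * c <_) (sym (÷-*-cancel a c)) bc<a)

  <*⇒÷< : ∀ a {b} → a < b * c → a ÷ c < b
  <*⇒÷< a {b} a<bc = *-cancelʳ-<′ c 0<c (subst (_< b * c) (sym (÷-*-cancel a c)) a<bc)

  <÷⇒*< : ∀ a {b} → b < a ÷ c → b * c < a
  <÷⇒*< a {b} b<a/c = subst (b * c <_) (÷-*-cancel a c) (*-monoˡ-<′ c 0<c b<a/c)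

  ÷<⇒<* : ∀ a {b} → a ÷ c < b → a < b * c
  ÷<⇒<* a {b} a/c<b = subst (_< b * c) (÷-*-cancel a c) (*-monoˡ-<′ c 0<c a/c<b)

  ÷-∈⟨0,1⟩ : ∀ a → 0ℚ < a → a < c → a ÷ c ∈⟨0,1⟩
  ÷-∈⟨0,1⟩ a 0<a a<c = *<⇒<÷ a (subst (_< a) (sym (*-zeroˡ c)) 0<a) , <*⇒÷< a (subst (a <_) (sym (*-identityˡ c)) a<c)

÷-cross-< : ∀ a b {c d} .{{_ : NonZero c}} .{{_ : NonZero d}} → 0ℚ < c → 0ℚ < d → a * d < b * c → a ÷ c < b ÷ d
÷-cross-< a b {c} {d} 0<c 0<d ad<bc = <*⇒÷< 0<c a (*-cancelʳ-<′ {a} d 0<d (subst (a * d <_) bc≡ad-form ad<bc))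
  where
  swap : ∀ x y z → x * y * z ≡ x * z * y
  swap = solve-∀ ℚ-ring
  bc≡ad-form : b * c ≡ b ÷ d * c * d
  bc≡ad-form = sym (trans (swap (b ÷ d) c d) (cong (_* c) (÷-*-cancel b d)))

⊔-lub-< : ∀ {p q r} → p < r → q < r → p ⊔ q < r
⊔-lub-< {p} {q} p<r q<r with ⊔-sel p q
... | inj₁ p⊔q≡p = subst (_< _) (sym p⊔q≡p) p<r
... | inj₂ p⊔q≡q = subst (_< _) (sym p⊔q≡q) q<r

⊓-glb-< : ∀ {p q r} → r < p → r < q → r < p ⊓ q
⊓-glb-< {p} {q} r<p r<q with ⊓-sel p q
... | inj₁ p⊓q≡p = subst (_ <_) (sym p⊓q≡p) r<p
... | inj₂ p⊓q≡q = subst (_ <_) (sym p⊓q≡q) r<q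

⊔-<⇒< : ∀ p q {r} → p ⊔ q < r → p < r × q < r
⊔-<⇒< p q p⊔q<r = ≤-<-trans (p≤p⊔q p q) p⊔q<r , ≤-<-trans (p≤q⊔p p q) p⊔q<r

<-⊓⇒< : ∀ p q {r} → r < p ⊓ q → r < p × r < q
<-⊓⇒< p q r<p⊓q = <-≤-trans r<p⊓q (p⊓q≤p p q) , <-≤-trans r<p⊓q (p⊓q≤q p q)

/1-homo-+ : ∀ i j → (i ℤ.+ j) / 1 ≡ i / 1 + j / 1
/1-homo-+ i j = toℚᵘ-injective (begin-equality
  toℚᵘ ((i ℤ.+ j) / 1)                 ≃⟨ toℚᵘ-fromℚᵘ (ℚᵘ.mkℚᵘ (i ℤ.+ j) 0) ⟩
  ℚᵘ.mkℚᵘ (i ℤ.+ j) 0                  ≃⟨ ℚᵘ.*≡* (sum-identity i j) ⟩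
  ℚᵘ.mkℚᵘ i 0 ℚᵘ.+ ℚᵘ.mkℚᵘ j 0          ≃⟨ ℚᵘₚ.+-cong (toℚᵘ-fromℚᵘ (ℚᵘ.mkℚᵘ i 0)) (toℚᵘ-fromℚᵘ (ℚᵘ.mkℚᵘ j 0)) ⟨
  toℚᵘ (i / 1) ℚᵘ.+ toℚᵘ (j / 1)        ≃⟨ toℚᵘ-homo-+ (i / 1) (j / 1) ⟨
  toℚᵘ (i / 1 + j / 1)                 ∎)
  where
  open ℚᵘₚ.≤-Reasoning
  sum-identity : ∀ i j → (i ℤ.+ j) ℤ.* (+ 1 ℤ.* + 1) ≡ (i ℤ.* + 1 ℤ.+ j ℤ.* + 1) ℤ.* + 1
  sum-identity = ℤ-Solver.solve-∀

/1-cancel-< : ∀ {i j} → i / 1 < j / 1 → i ℤ.< j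
/1-cancel-< {i} {j} i<j with ℚᵘₚ.<-respʳ-≃ (toℚᵘ-fromℚᵘ (ℚᵘ.mkℚᵘ j 0)) (ℚᵘₚ.<-respˡ-≃ (toℚᵘ-fromℚᵘ (ℚᵘ.mkℚᵘ i 0)) (toℚᵘ-mono-< i<j))
... | ℚᵘ.*<* i*1<j*1 = subst₂ ℤ._<_ (ℤₚ.*-identityʳ i) (ℤₚ.*-identityʳ j) i*1<j*1

/1-<-1+⇒≤ : ∀ {i j} → i / 1 < 1ℚ + j / 1 → i ℤ.≤ j
/1-<-1+⇒≤ {i} {j} i<1+j = ℤₚ.≮⇒≥ λ j<i →
  ℤₚ.<⇒≱ (/1-cancel-< (subst (i / 1 <_) (sym (/1-homo-+ (+ 1) j)) i<1+j)) (ℤₚ.i<j⇒suc[i]≤j j<i)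

fromℕ : ℕ → ℚ
fromℕ k = + k / 1

fromℕ-+ : ∀ m n → fromℕ (m ℕ.+ n) ≡ fromℕ m + fromℕ n
fromℕ-+ m n = /1-homo-+ (+ m) (+ n)

fromℕ-suc : ∀ k → fromℕ (suc k) ≡ 1ℚ + fromℕ k
fromℕ-suc = fromℕ-+ 1

fromℕ-pos : ∀ k → 0ℚ < fromℕ (suc k)
fromℕ-pos k = positive⁻¹ (fromℕ (suc k)) {{normalize-pos (suc k) 1}}

fromℕ-nonZero-pos : ∀ n .{{_ : ℕ.NonZero n}} → 0ℚ < fromℕ n
fromℕ-nonZero-pos (suc k) = fromℕ-pos k

/-*-fromℕ : ∀ i n .{{_ : ℕ.NonZero n}} → (i / n) * fromℕ n ≡ i / 1
/-*-fromℕ i (suc m) = toℚᵘ-injective (begin-equality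
  toℚᵘ (i / suc m * fromℕ (suc m))              ≃⟨ toℚᵘ-homo-* (i / suc m) (fromℕ (suc m)) ⟩
  toℚᵘ (i / suc m) ℚᵘ.* toℚᵘ (fromℕ (suc m))    ≃⟨ ℚᵘₚ.*-cong (toℚᵘ-fromℚᵘ (ℚᵘ.mkℚᵘ i m)) (toℚᵘ-fromℚᵘ (ℚᵘ.mkℚᵘ (+ suc m) 0)) ⟩
  ℚᵘ.mkℚᵘ i m ℚᵘ.* ℚᵘ.mkℚᵘ (+ suc m) 0           ≃⟨ ℚᵘ.*≡* (trans (ℤₚ.*-identityʳ (i ℤ.* + suc m)) (cong (λ k → i ℤ.* + suc k) (sym (ℕₚ.*-identityʳ m)))) ⟩
  ℚᵘ.mkℚᵘ i 0                                   ≃⟨ toℚᵘ-fromℚᵘ (ℚᵘ.mkℚᵘ i 0) ⟨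
  toℚᵘ (i / 1)                                  ∎)
  where open ℚᵘₚ.≤-Reasoning

Σℚ-cong : ∀ {n} {f g : Fin n → ℚ} → (∀ i → f i ≡ g i) → Σℚ f ≡ Σℚ g
Σℚ-cong {zero}  f≗g = refl
Σℚ-cong {suc n} f≗g = cong₂ _+_ (f≗g zero) (Σℚ-cong (λ i → f≗g (suc i)))

Σℚ-const : ∀ n c → Σℚ {n} (λ _ → c) ≡ fromℕ n * c
Σℚ-const zero    c = sym (*-zeroˡ c)
Σℚ-const (suc n) c = begin
  c + Σℚ {n} (λ _ → c)   ≡⟨ cong (_+_ c) (Σℚ-const n c) ⟩
  c + fromℕ n * c        ≡⟨ cong (_+ fromℕ n * c) (*-identityˡ c) ⟨
  1ℚ * c + fromℕ n * c   ≡⟨ *-distribʳ-+ c 1ℚ (fromℕ n) ⟨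
  (1ℚ + fromℕ n) * c     ≡⟨ cong (_* c) (fromℕ-suc n) ⟨
  fromℕ (suc n) * c      ∎
  where open ≡-Reasoning

Σℚ-punchOut : ∀ {n} (f g : Fin n → ℚ) k → f k ≡ 0ℚ → (∀ j → j ≢ k → f j ≡ g j) → Σℚ f + g k ≡ Σℚ g
Σℚ-punchOut {suc n} f g zero fk≡0 f≗g = begin
  f zero + Σℚ (tail f) + g zero   ≡⟨ cong₂ (λ a s → a + s + g zero) fk≡0 (Σℚ-cong (λ j → f≗g (suc j) λ ())) ⟩
  0ℚ + Σℚ (tail g) + g zero       ≡⟨ rotate (Σℚ (tail g)) (g zero) ⟩
  g zero + Σℚ (tail g)            ∎
  where
  open ≡-Reasoning
  rotate : ∀ s a → 0ℚ + s + a ≡ a + s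
  rotate = solve-∀ ℚ-ring
Σℚ-punchOut {suc n} f g (suc k) fk≡0 f≗g = begin
  f zero + Σℚ (tail f) + g (suc k)     ≡⟨ +-assoc (f zero) (Σℚ (tail f)) (g (suc k)) ⟩
  f zero + (Σℚ (tail f) + g (suc k))   ≡⟨ cong₂ _+_ (f≗g zero λ ()) (Σℚ-punchOut (tail f) (tail g) k fk≡0 (λ j j≢k → f≗g (suc j) (λ { refl → j≢k refl }))) ⟩
  g zero + Σℚ (tail g)                 ∎
  where open ≡-Reasoning

-- The summand of offDiagSum is local to Defs; unifying offDiagSum x k with Σℚ f names it.
offDiagSummand : ∀ {n} → (Fin n → Fin n → ℚ) → Fin n → Fin n → ℚ
offDiagSummand x k = summandOf (offDiagSum x k) refl
  where
  summandOf : ∀ {n} {f : Fin n → ℚ} s → s ≡ Σℚ f → Fin n → ℚ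
  summandOf {f = f} _ _ = f

offDiagSummand-diagonal : ∀ {n} (x : Fin n → Fin n → ℚ) k → offDiagSummand x k k ≡ 0ℚ
offDiagSummand-diagonal x k with k ≟ k
... | yes _   = refl
... | no k≢k = ⊥-elim (k≢k refl)

offDiagSummand-off : ∀ {n} (x : Fin n → Fin n → ℚ) k j → j ≢ k → offDiagSummand x k j ≡ x j k
offDiagSummand-off x k j j≢k with j ≟ k
... | yes j≡k = ⊥-elim (j≢k j≡k)
... | no _    = refl

offDiagSum-+-diagonal : ∀ {n} (x : Fin n → Fin n → ℚ) k → offDiagSum x k + x k k ≡ Σℚ (λ j → x j k)
offDiagSum-+-diagonal x k =
  Σℚ-punchOut (offDiagSummand x k) (λ j → x j k) k (offDiagSummand-diagonal x k) (offDiagSummand-off x k)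

offDiagSum-const : ∀ n c k → offDiagSum {suc n} (λ _ _ → c) k ≡ fromℕ n * c
offDiagSum-const n c k = +-cancelʳ-≡ c (offDiagSum (λ _ _ → c) k) (fromℕ n * c) (begin
  offDiagSum (λ _ _ → c) k + c   ≡⟨ offDiagSum-+-diagonal (λ _ _ → c) k ⟩
  Σℚ {suc n} (λ _ → c)           ≡⟨ Σℚ-const (suc n) c ⟩
  fromℕ (suc n) * c              ≡⟨ cong (_* c) (fromℕ-suc n) ⟩
  (1ℚ + fromℕ n) * c             ≡⟨ unfold (fromℕ n) c ⟩
  fromℕ n * c + c                ∎)
  where
  open ≡-Reasoning
  unfold : ∀ ν c → (1ℚ + ν) * c ≡ ν * c + c
  unfold = solve-∀ ℚ-ring

-- Type assignments and the expectation over independent types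

count : ∀ {n} → Vector Bool n → ℕ
count {zero}  σ = 0
count {suc n} σ = if head σ then suc (count (tail σ)) else count (tail σ)

count+count-not : ∀ {n} (σ : Vector Bool n) → count σ ℕ.+ count (not ∘ σ) ≡ n
count+count-not {zero}  σ = refl
count+count-not {suc n} σ with head σ
... | true  = cong suc (count+count-not (tail σ))
... | false = trans (ℕₚ.+-suc (count (tail σ)) (count (not ∘ tail σ))) (cong suc (count+count-not (tail σ)))

Σℚ-∘-Bool : ∀ {n} (σ : Vector Bool n) (g : Bool → ℚ) →
  Σℚ (λ j → g (σ j)) ≡ fromℕ (count σ) * g true + fromℕ (count (not ∘ σ)) * g false
Σℚ-∘-Bool {zero}  σ g = sym (trans (cong₂ _+_ (*-zeroˡ (g true)) (*-zeroˡ (g false))) (+-identityˡ 0ℚ))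
Σℚ-∘-Bool {suc n} σ g with head σ | Σℚ-∘-Bool (tail σ) g
... | true  | IH = begin
  g true + Σℚ (λ j → g (tail σ j))                     ≡⟨ cong (_+_ (g true)) IH ⟩
  g true + (fromℕ t * g true + fromℕ f * g false)      ≡⟨ add-one (g true) (g false) (fromℕ t) (fromℕ f) ⟩
  (1ℚ + fromℕ t) * g true + fromℕ f * g false          ≡⟨ cong (λ c → c * g true + fromℕ f * g false) (fromℕ-suc t) ⟨
  fromℕ (suc t) * g true + fromℕ f * g false           ∎
  where
  open ≡-Reasoning
  t f : ℕ
  t = count (tail σ)
  f = count (not ∘ tail σ)
  add-one : ∀ a b c d → a + (c * a + d * b) ≡ (1ℚ + c) * a + d * b
  add-one = solve-∀ ℚ-ring
... | false | IH = begin
  g false + Σℚ (λ j → g (tail σ j))                    ≡⟨ cong (_+_ (g false)) IH ⟩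
  g false + (fromℕ t * g true + fromℕ f * g false)     ≡⟨ add-one (g true) (g false) (fromℕ t) (fromℕ f) ⟩
  fromℕ t * g true + (1ℚ + fromℕ f) * g false          ≡⟨ cong (λ c → fromℕ t * g true + c * g false) (fromℕ-suc f) ⟨
  fromℕ t * g true + fromℕ (suc f) * g false           ∎
  where
  open ≡-Reasoning
  t f : ℕ
  t = count (tail σ)
  f = count (not ∘ tail σ)
  add-one : ∀ a b c d → b + (c * a + d * b) ≡ c * a + (1ℚ + d) * b
  add-one = solve-∀ ℚ-ring

Σ𝔹 : ∀ n → (Vector Bool n → ℚ) → ℚ
Σ𝔹 zero    F = F (λ ())
Σ𝔹 (suc n) F = Σ𝔹 n (λ σ → F (true ∷ σ)) + Σ𝔹 n (λ σ → F (false ∷ σ))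

Σ𝔹-cong : ∀ n {F G : Vector Bool n → ℚ} → (∀ σ → F σ ≡ G σ) → Σ𝔹 n F ≡ Σ𝔹 n G
Σ𝔹-cong zero    F≗G = F≗G _
Σ𝔹-cong (suc n) F≗G = cong₂ _+_ (Σ𝔹-cong n (λ σ → F≗G _)) (Σ𝔹-cong n (λ σ → F≗G _))

Σ𝔹-+ : ∀ n (F G : Vector Bool n → ℚ) → Σ𝔹 n (λ σ → F σ + G σ) ≡ Σ𝔹 n F + Σ𝔹 n G
Σ𝔹-+ zero    F G = refl
Σ𝔹-+ (suc n) F G = trans (cong₂ _+_ (Σ𝔹-+ n (F ∘ (true ∷_)) (G ∘ (true ∷_))) (Σ𝔹-+ n (F ∘ (false ∷_)) (G ∘ (false ∷_))))
                         (interchange (Σ𝔹 n (F ∘ (true ∷_))) (Σ𝔹 n (G ∘ (true ∷_))) (Σ𝔹 n (F ∘ (false ∷_))) (Σ𝔹 n (G ∘ (false ∷_))))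
  where
  interchange : ∀ a b c d → a + b + (c + d) ≡ a + c + (b + d)
  interchange = solve-∀ ℚ-ring

Σ𝔹-*ˡ : ∀ n c (F : Vector Bool n → ℚ) → Σ𝔹 n (λ σ → c * F σ) ≡ c * Σ𝔹 n F
Σ𝔹-*ˡ zero    c F = refl
Σ𝔹-*ˡ (suc n) c F = trans (cong₂ _+_ (Σ𝔹-*ˡ n c _) (Σ𝔹-*ˡ n c _)) (sym (*-distribˡ-+ c _ _))

Σ𝔹-pos : ∀ n (F : Vector Bool n → ℚ) → (∀ σ → 0ℚ < F σ) → 0ℚ < Σ𝔹 n F
Σ𝔹-pos zero    F 0<F = 0<F _
Σ𝔹-pos (suc n) F 0<F = +-pos (Σ𝔹-pos n _ (λ σ → 0<F _)) (Σ𝔹-pos n _ (λ σ → 0<F _))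

bernoulli : ℚ → Bool → ℚ
bernoulli t true  = t
bernoulli t false = 1ℚ - t

weight : ∀ {n} → Vector ℚ n → Vector Bool n → ℚ
weight {zero}  θ σ = 1ℚ
weight {suc n} θ σ = bernoulli (head θ) (head σ) * weight (tail θ) (tail σ)

𝔼 : ∀ {n} → Vector ℚ n → (Vector Bool n → ℚ) → ℚ
𝔼 {n} θ F = Σ𝔹 n (λ σ → weight θ σ * F σ)

𝔼-cong : ∀ {n} (θ : Vector ℚ n) {F G : Vector Bool n → ℚ} → (∀ σ → F σ ≡ G σ) → 𝔼 θ F ≡ 𝔼 θ G
𝔼-cong {n} θ F≗G = Σ𝔹-cong n (λ σ → cong (weight θ σ *_) (F≗G σ))

𝔼-+ : ∀ {n} (θ : Vector ℚ n) (F G : Vector Bool n → ℚ) → 𝔼 θ (λ σ → F σ + G σ) ≡ 𝔼 θ F + 𝔼 θ G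
𝔼-+ {n} θ F G = trans (Σ𝔹-cong n (λ σ → *-distribˡ-+ (weight θ σ) (F σ) (G σ))) (Σ𝔹-+ n _ _)

𝔼-∷ : ∀ {n} (θ : Vector ℚ (suc n)) (F : Vector Bool (suc n) → ℚ) →
  𝔼 θ F ≡ head θ * 𝔼 (tail θ) (λ σ → F (true ∷ σ)) + (1ℚ - head θ) * 𝔼 (tail θ) (λ σ → F (false ∷ σ))
𝔼-∷ {n} θ F = cong₂ _+_ (condition (head θ) (λ σ → F (true ∷ σ))) (condition (1ℚ - head θ) (λ σ → F (false ∷ σ)))
  where
  condition : ∀ t G → Σ𝔹 n (λ σ → t * weight (tail θ) σ * G σ) ≡ t * 𝔼 (tail θ) G
  condition t G = trans (Σ𝔹-cong n (λ σ → *-assoc t _ _)) (Σ𝔹-*ˡ n t _)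

𝔼-const : ∀ {n} (θ : Vector ℚ n) c → 𝔼 θ (λ _ → c) ≡ c
𝔼-const {zero}  θ c = *-identityˡ c
𝔼-const {suc n} θ c = begin
  𝔼 θ (λ _ → c)                                                ≡⟨ 𝔼-∷ θ (λ _ → c) ⟩
  head θ * 𝔼 (tail θ) (λ _ → c) + (1ℚ - head θ) * 𝔼 (tail θ) (λ _ → c)
                                                               ≡⟨ cong₂ (λ a b → head θ * a + (1ℚ - head θ) * b) (𝔼-const (tail θ) c) (𝔼-const (tail θ) c) ⟩
  head θ * c + (1ℚ - head θ) * c                               ≡⟨ mix (head θ) c ⟩
  c                                                            ∎
  where
  open ≡-Reasoning
  mix : ∀ t c → t * c + (1ℚ - t) * c ≡ c
  mix = solve-∀ ℚ-ring

𝔼-coordinate : ∀ {n} (θ : Vector ℚ n) k (h : Bool → ℚ) →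
  𝔼 θ (λ σ → h (σ k)) ≡ θ k * h true + (1ℚ - θ k) * h false
𝔼-coordinate θ zero h = trans (𝔼-∷ θ (λ σ → h (σ zero)))
  (cong₂ (λ a b → head θ * a + (1ℚ - head θ) * b) (𝔼-const (tail θ) (h true)) (𝔼-const (tail θ) (h false)))
𝔼-coordinate θ (suc k) h = begin
  𝔼 θ (λ σ → h (σ (suc k)))                                   ≡⟨ 𝔼-∷ θ (λ σ → h (σ (suc k))) ⟩
  head θ * 𝔼 (tail θ) (λ σ → h (σ k)) + (1ℚ - head θ) * 𝔼 (tail θ) (λ σ → h (σ k))
                                                              ≡⟨ cong₂ (λ a b → head θ * a + (1ℚ - head θ) * b) IH IH ⟩
  head θ * m + (1ℚ - head θ) * m                              ≡⟨ mix (head θ) m ⟩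
  m                                                           ∎
  where
  open ≡-Reasoning
  m : ℚ
  m = θ (suc k) * h true + (1ℚ - θ (suc k)) * h false
  IH : 𝔼 (tail θ) (λ σ → h (σ k)) ≡ m
  IH = 𝔼-coordinate (tail θ) k h
  mix : ∀ t c → t * c + (1ℚ - t) * c ≡ c
  mix = solve-∀ ℚ-ring

Σℚ-𝔼 : ∀ {m n} (θ : Vector ℚ n) (F : Fin m → Vector Bool n → ℚ) →
  Σℚ (λ j → 𝔼 θ (F j)) ≡ 𝔼 θ (λ σ → Σℚ (λ j → F j σ))
Σℚ-𝔼 {zero}  θ F = sym (𝔼-const θ 0ℚ)
Σℚ-𝔼 {suc m} θ F = trans (cong (_+_ (𝔼 θ (F zero))) (Σℚ-𝔼 θ (tail F))) (sym (𝔼-+ θ (F zero) _))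

weight-pos : ∀ {n} (θ : Vector ℚ n) → (∀ i → θ i ∈⟨0,1⟩) → ∀ σ → 0ℚ < weight θ σ
weight-pos {zero}  θ θ∈ σ = positive⁻¹ 1ℚ
weight-pos {suc n} θ θ∈ σ = *-pos (bernoulli-pos (head σ)) (weight-pos (tail θ) (θ∈ ∘ suc) (tail σ))
  where
  bernoulli-pos : ∀ b → 0ℚ < bernoulli (head θ) b
  bernoulli-pos true  = proj₁ (θ∈ zero)
  bernoulli-pos false = p<q⇒0<q-p (proj₂ (θ∈ zero))

𝔼-∈⟨0,1⟩ : ∀ {n} (θ : Vector ℚ n) → (∀ i → θ i ∈⟨0,1⟩) →
  (F : Vector Bool n → ℚ) → (∀ σ → F σ ∈⟨0,1⟩) → 𝔼 θ F ∈⟨0,1⟩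
𝔼-∈⟨0,1⟩ {n} θ θ∈ F F∈ =
  𝔼-pos F (proj₁ ∘ F∈) , pos+≡⇒< (𝔼-pos (λ σ → 1ℚ - F σ) (p<q⇒0<q-p ∘ proj₂ ∘ F∈)) complement
  where
  𝔼-pos : ∀ G → (∀ σ → 0ℚ < G σ) → 0ℚ < 𝔼 θ G
  𝔼-pos G 0<G = Σ𝔹-pos n _ (λ σ → *-pos (weight-pos θ θ∈ σ) (0<G σ))
  cancel : ∀ a b → a - b + b ≡ a
  cancel = solve-∀ ℚ-ring
  complement : 𝔼 θ (λ σ → 1ℚ - F σ) + 𝔼 θ F ≡ 1ℚ
  complement = begin
    𝔼 θ (λ σ → 1ℚ - F σ) + 𝔼 θ F   ≡⟨ 𝔼-+ θ _ F ⟨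
    𝔼 θ (λ σ → 1ℚ - F σ + F σ)     ≡⟨ 𝔼-cong θ (λ σ → cancel 1ℚ (F σ)) ⟩
    𝔼 θ (λ _ → 1ℚ)                 ≡⟨ 𝔼-const θ 1ℚ ⟩
    1ℚ                             ∎
    where open ≡-Reasoning

offDiagSum-𝔼 : ∀ {n} (θ : Vector ℚ n) (Z : Vector Bool n → Fin n → Fin n → ℚ) (d : Bool → ℚ) →
  (∀ σ k → offDiagSum (Z σ) k ≡ d (σ k)) →
  ∀ k → offDiagSum (λ i j → 𝔼 θ (λ σ → Z σ i j)) k ≡ θ k * d true + (1ℚ - θ k) * d false
offDiagSum-𝔼 θ Z d offDiagSum-Z k = +-cancelʳ-≡ (y k k) _ _ (begin
  offDiagSum y k + y k k                         ≡⟨ offDiagSum-+-diagonal y k ⟩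
  Σℚ (λ j → y j k)                               ≡⟨ Σℚ-𝔼 θ (λ j σ → Z σ j k) ⟩
  𝔼 θ (λ σ → Σℚ (λ j → Z σ j k))                 ≡⟨ 𝔼-cong θ (λ σ → sym (offDiagSum-+-diagonal (Z σ) k)) ⟩
  𝔼 θ (λ σ → offDiagSum (Z σ) k + Z σ k k)       ≡⟨ 𝔼-cong θ (λ σ → cong (_+ Z σ k k) (offDiagSum-Z σ k)) ⟩
  𝔼 θ (λ σ → d (σ k) + Z σ k k)                  ≡⟨ 𝔼-+ θ (λ σ → d (σ k)) (λ σ → Z σ k k) ⟩
  𝔼 θ (λ σ → d (σ k)) + y k k                    ≡⟨ cong (_+ y k k) (𝔼-coordinate θ k d) ⟩
  θ k * d true + (1ℚ - θ k) * d false + y k k    ∎)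
  where
  open ≡-Reasoning
  y : Fin _ → Fin _ → ℚ
  y i j = 𝔼 θ (λ σ → Z σ i j)

-- Matrices whose entries depend only on the types of the endpoints

-- Weights for k vertices of type true and l of type false; the degree equation of a vertex
-- of type b sums over all vertices, itself included, hence the term w b b on the right.
record TwoTypeWeights (k l : ℚ) (d : Bool → ℚ) : Set where
  field
    w        : Bool → Bool → ℚ
    w-sym    : ∀ a b → w a b ≡ w b a
    w-∈⟨0,1⟩ : ∀ a b → w a b ∈⟨0,1⟩
    degree   : ∀ b → k * w true b + l * w false b ≡ d b + w b b

twoTypeWeights : ∀ {k l d} p r q → p ∈⟨0,1⟩ → r ∈⟨0,1⟩ → q ∈⟨0,1⟩ →
  k * p + l * r ≡ d true + p → k * r + l * q ≡ d false + q → TwoTypeWeights k l d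
twoTypeWeights {k} {l} {d} p r q p∈ r∈ q∈ degree-true degree-false =
  record { w = w ; w-sym = w-sym ; w-∈⟨0,1⟩ = w-∈ ; degree = degree }
  where
  w : Bool → Bool → ℚ
  w true  true  = p
  w true  false = r
  w false true  = r
  w false false = q
  w-sym : ∀ a b → w a b ≡ w b a
  w-sym true  true  = refl
  w-sym true  false = refl
  w-sym false true  = refl
  w-sym false false = refl
  w-∈ : ∀ a b → w a b ∈⟨0,1⟩
  w-∈ true  true  = p∈
  w-∈ true  false = r∈
  w-∈ false true  = r∈
  w-∈ false false = q∈
  degree : ∀ b → k * w true b + l * w false b ≡ d b + w b b
  degree true  = degree-true
  degree false = degree-false

typedMatrix : ∀ {n} → (Bool → Bool → ℚ) → Vector Bool n → Fin n → Fin n → ℚ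
typedMatrix w σ i j = w (σ i) (σ j)

offDiagSum-typedMatrix : ∀ {n d} (σ : Vector Bool n) (T : TwoTypeWeights (fromℕ (count σ)) (fromℕ (count (not ∘ σ))) d) k →
  offDiagSum (typedMatrix (TwoTypeWeights.w T) σ) k ≡ d (σ k)
offDiagSum-typedMatrix {d = d} σ T k = +-cancelʳ-≡ (Z k k) _ _ (begin
  offDiagSum Z k + Z k k                                                 ≡⟨ offDiagSum-+-diagonal Z k ⟩
  Σℚ (λ j → w (σ j) (σ k))                                               ≡⟨ Σℚ-∘-Bool σ (λ a → w a (σ k)) ⟩
  fromℕ (count σ) * w true (σ k) + fromℕ (count (not ∘ σ)) * w false (σ k)  ≡⟨ degree (σ k) ⟩
  d (σ k) + Z k k                                                        ∎)
  where
  open ≡-Reasoning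
  open TwoTypeWeights T
  Z : Fin _ → Fin _ → ℚ
  Z = typedMatrix w σ

between-bounds : ∀ {l₁ l₂ u₁ u₂} → l₁ < u₁ → l₁ < u₂ → l₁ < 1ℚ → l₂ < u₁ → l₂ < u₂ → l₂ < 1ℚ → 0ℚ < u₁ → 0ℚ < u₂ →
  Σ ℚ λ r → r ∈⟨0,1⟩ × (l₁ < r × r < u₁) × (l₂ < r × r < u₂)
between-bounds {l₁} {l₂} {u₁} {u₂} l₁<u₁ l₁<u₂ l₁<1 l₂<u₁ l₂<u₂ l₂<1 0<u₁ 0<u₂ =
  r , (0<r , r<1) , (l₁<r , r<u₁) , (l₂<r , r<u₂)
  where
  L<U : (l₁ ⊔ l₂) ⊔ 0ℚ < (u₁ ⊓ u₂) ⊓ 1ℚ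
  L<U = ⊔-lub-< (⊔-lub-< (⊓-glb-< (⊓-glb-< l₁<u₁ l₁<u₂) l₁<1) (⊓-glb-< (⊓-glb-< l₂<u₁ l₂<u₂) l₂<1))
                (⊓-glb-< (⊓-glb-< 0<u₁ 0<u₂) (positive⁻¹ 1ℚ))
  r : ℚ
  r = proj₁ (<-dense L<U)
  L<r : (l₁ ⊔ l₂) ⊔ 0ℚ < r
  L<r = proj₁ (proj₂ (<-dense L<U))
  r<U : r < (u₁ ⊓ u₂) ⊓ 1ℚ
  r<U = proj₂ (proj₂ (<-dense L<U))
  l₁<r : l₁ < r
  l₁<r = proj₁ (⊔-<⇒< l₁ l₂ (proj₁ (⊔-<⇒< (l₁ ⊔ l₂) 0ℚ L<r)))
  l₂<r : l₂ < r
  l₂<r = proj₂ (⊔-<⇒< l₁ l₂ (proj₁ (⊔-<⇒< (l₁ ⊔ l₂) 0ℚ L<r)))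
  0<r : 0ℚ < r
  0<r = proj₂ (⊔-<⇒< (l₁ ⊔ l₂) 0ℚ L<r)
  r<u₁ : r < u₁
  r<u₁ = proj₁ (<-⊓⇒< u₁ u₂ (proj₁ (<-⊓⇒< (u₁ ⊓ u₂) 1ℚ r<U)))
  r<u₂ : r < u₂
  r<u₂ = proj₂ (<-⊓⇒< u₁ u₂ (proj₁ (<-⊓⇒< (u₁ ⊓ u₂) 1ℚ r<U)))
  r<1 : r < 1ℚ
  r<1 = proj₂ (<-⊓⇒< (u₁ ⊓ u₂) 1ℚ r<U)

classWeight : ∀ {A c a r} .{{_ : NonZero c}} → 0ℚ < A → 0ℚ < c → (a - A) ÷ c < r → r < a ÷ c →
  Σ ℚ λ p → p ∈⟨0,1⟩ × A * p + c * r ≡ a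
classWeight {A} {c} {a} {r} 0<A 0<c l<r r<u = p , ÷-∈⟨0,1⟩ 0<A (a - c * r) 0<a-cr a-cr<A , degree
  where
  instance
    A≢0 : NonZero A
    A≢0 = >-nonZero 0<A
  p : ℚ
  p = (a - c * r) ÷ A
  0<a-cr : 0ℚ < a - c * r
  0<a-cr = p<q⇒0<q-p (subst (_< a) (*-comm r c) (<÷⇒*< 0<c a r<u))
  a-cr<A : a - c * r < A
  a-cr<A = -<⇒-< a (subst (a - A <_) (*-comm r c) (÷<⇒<* 0<c (a - A) l<r))
  cancel : ∀ a x → a - x + x ≡ a
  cancel = solve-∀ ℚ-ring
  degree : A * p + c * r ≡ a
  degree = begin
    A * p + c * r            ≡⟨ cong (_+ c * r) (*-comm A p) ⟩
    p * A + c * r            ≡⟨ cong (_+ c * r) (÷-*-cancel (a - c * r) A) ⟩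
    a - c * r + c * r        ≡⟨ cancel a (c * r) ⟩
    a                        ∎
    where open ≡-Reasoning

twoTypeWeights-bounded : ∀ {A B} (d : Bool → ℚ) → 0ℚ < A → 0ℚ < B → 0ℚ < d true → 0ℚ < d false →
  d true < A + B + 1ℚ → d false < A + B + 1ℚ →
  (d true - A) * (A + 1ℚ) < d false * (B + 1ℚ) → (d false - B) * (B + 1ℚ) < d true * (A + 1ℚ) →
  TwoTypeWeights (A + 1ℚ) (B + 1ℚ) d
twoTypeWeights-bounded {A} {B} d 0<A 0<B 0<a 0<b a<A+B+1 b<A+B+1 cross₁ cross₂ =
  twoTypeWeights p r q p∈ r∈ q∈ (trans (regroup A p (c₁ * r)) (cong (_+ p) high-degree))
    (trans (+-comm (c₂ * r) (c₁ * q)) (trans (regroup B q (c₂ * r)) (cong (_+ q) low-degree)))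
  where
  a b c₁ c₂ : ℚ
  a = d true
  b = d false
  c₁ = B + 1ℚ
  c₂ = A + 1ℚ
  0<c₁ : 0ℚ < c₁
  0<c₁ = +-pos 0<B (positive⁻¹ 1ℚ)
  0<c₂ : 0ℚ < c₂
  0<c₂ = +-pos 0<A (positive⁻¹ 1ℚ)
  instance
    c₁≢0 : NonZero c₁
    c₁≢0 = >-nonZero 0<c₁
    c₂≢0 : NonZero c₂
    c₂≢0 = >-nonZero 0<c₂

  below : ∀ {x y} → 0ℚ < y → x - y < x
  below {x} {y} 0<y = 0<q-p⇒p<q (subst (0ℚ <_) (sym (cancel x y)) 0<y)
    where
    cancel : ∀ x y → x - (x - y) ≡ y
    cancel = solve-∀ ℚ-ring

  under-1 : ∀ {x y z} → x < y + z + 1ℚ → x - y < 1ℚ * (z + 1ℚ)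
  under-1 {x} {y} {z} x<y+z+1 = 0<q-p⇒p<q (subst (0ℚ <_) (rearrange x y z) (p<q⇒0<q-p x<y+z+1))
    where
    rearrange : ∀ x y z → y + z + 1ℚ - x ≡ 1ℚ * (z + 1ℚ) - (x - y)
    rearrange = solve-∀ ℚ-ring

  swap : ∀ A B → A + B + 1ℚ ≡ B + A + 1ℚ
  swap = solve-∀ ℚ-ring

  interval : Σ ℚ λ r → r ∈⟨0,1⟩ × ((a - A) ÷ c₁ < r × r < a ÷ c₁) × ((b - B) ÷ c₂ < r × r < b ÷ c₂)
  interval = between-bounds
    (<*⇒÷< 0<c₁ (a - A) (subst (a - A <_) (sym (÷-*-cancel a c₁)) (below 0<A)))
    (÷-cross-< (a - A) b 0<c₁ 0<c₂ cross₁)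
    (<*⇒÷< 0<c₁ (a - A) (under-1 a<A+B+1))
    (÷-cross-< (b - B) a 0<c₂ 0<c₁ cross₂)
    (<*⇒÷< 0<c₂ (b - B) (subst (b - B <_) (sym (÷-*-cancel b c₂)) (below 0<B)))
    (<*⇒÷< 0<c₂ (b - B) (under-1 (subst (b <_) (swap A B) b<A+B+1)))
    (*<⇒<÷ 0<c₁ a (subst (_< a) (sym (*-zeroˡ c₁)) 0<a))
    (*<⇒<÷ 0<c₂ b (subst (_< b) (sym (*-zeroˡ c₂)) 0<b))

  r : ℚ
  r = proj₁ interval
  r∈ : r ∈⟨0,1⟩
  r∈ = proj₁ (proj₂ interval)

  high : Σ ℚ λ p → p ∈⟨0,1⟩ × A * p + c₁ * r ≡ a
  high = classWeight 0<A 0<c₁ (proj₁ (proj₁ (proj₂ (proj₂ interval)))) (proj₂ (proj₁ (proj₂ (proj₂ interval))))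
  low : Σ ℚ λ q → q ∈⟨0,1⟩ × B * q + c₂ * r ≡ b
  low = classWeight 0<B 0<c₂ (proj₁ (proj₂ (proj₂ (proj₂ interval)))) (proj₂ (proj₂ (proj₂ (proj₂ interval))))

  p q : ℚ
  p = proj₁ high
  q = proj₁ low
  p∈ : p ∈⟨0,1⟩
  p∈ = proj₁ (proj₂ high)
  q∈ : q ∈⟨0,1⟩
  q∈ = proj₁ (proj₂ low)
  high-degree : A * p + c₁ * r ≡ a
  high-degree = proj₂ (proj₂ high)
  low-degree : B * q + c₂ * r ≡ b
  low-degree = proj₂ (proj₂ low)

  regroup : ∀ A p x → (A + 1ℚ) * p + x ≡ A * p + x + p
  regroup = solve-∀ ℚ-ring

mixtureOfTwoTypes : ∀ {n} (θ : Vector ℚ n) → (∀ i → θ i ∈⟨0,1⟩) → (d : Bool → ℚ) →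
  ((σ : Vector Bool n) → TwoTypeWeights (fromℕ (count σ)) (fromℕ (count (not ∘ σ))) d) →
  Σ (Fin n → Fin n → ℚ) λ y → Symmetric y × (∀ j k → y j k ∈⟨0,1⟩)
    × (∀ k → offDiagSum y k ≡ θ k * d true + (1ℚ - θ k) * d false)
mixtureOfTwoTypes {n} θ θ∈ d T = y , y-sym , y-∈ , offDiagSum-𝔼 θ Z d (λ σ → offDiagSum-typedMatrix σ (T σ))
  where
  Z : Vector Bool n → Fin n → Fin n → ℚ
  Z σ = typedMatrix (TwoTypeWeights.w (T σ)) σ
  y : Fin n → Fin n → ℚ
  y i j = 𝔼 θ (λ σ → Z σ i j)
  y-sym : Symmetric y
  y-sym i j = 𝔼-cong θ (λ σ → TwoTypeWeights.w-sym (T σ) (σ i) (σ j))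
  y-∈ : ∀ i j → y i j ∈⟨0,1⟩
  y-∈ i j = 𝔼-∈⟨0,1⟩ θ θ∈ (λ σ → Z σ i j) (λ σ → TwoTypeWeights.w-∈⟨0,1⟩ (T σ) (σ i) (σ j))

retype : ∀ {k k′ l l′ d d′} → k ≡ k′ → l ≡ l′ → d ≡ d′ → TwoTypeWeights k l d → TwoTypeWeights k′ l′ d′
retype refl refl refl T = T

quadratic-pos : ∀ b c x → b * b < + 4 / 1 * c → 0ℚ < x * x - b * x + c
quadratic-pos b c x b²<4c = *-cancelʳ-<′ (+ 4 / 1) (positive⁻¹ (+ 4 / 1)) (subst₂ _<_ (sym (*-zeroˡ (+ 4 / 1))) (complete-square x b c)
  (+-pos-nonNeg (p<q⇒0<q-p b²<4c) (square-nonNeg (x + x - b))))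
  where
  complete-square : ∀ x b c → + 4 / 1 * c - b * b + (x + x - b) * (x + x - b) ≡ (x * x - b * x + c) * (+ 4 / 1)
  complete-square = solve-∀ ℚ-ring

module DensityWeights {α β : ℚ} (0<α : 0ℚ < α) (α<β : α < β) (β<1 : β < 1ℚ) where

  densityDegree : ℚ → Bool → ℚ
  densityDegree ν true  = β * ν
  densityDegree ν false = α * ν

  -- For ν = A + B + 1, positivity of Φ ν α at A + 1 and of Φ ν β at B + 1 are the cross
  -- conditions of twoTypeWeights-bounded for A + 1 high and B + 1 low vertices.
  Φ : ℚ → ℚ → ℚ → ℚ
  Φ ν γ x = x * x - (1ℚ + (α + β) * ν) * x + γ * ν * (ν + 1ℚ)

  NegativeDiscriminant : ℚ → Set
  NegativeDiscriminant ν = (1ℚ + (α + β) * ν) * (1ℚ + (α + β) * ν) < + 4 / 1 * (α * ν * (ν + 1ℚ))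

  α∈ : α ∈⟨0,1⟩
  α∈ = 0<α , <-trans α<β β<1

  β∈ : β ∈⟨0,1⟩
  β∈ = <-trans 0<α α<β , β<1

  module _ {ν} (disc : NegativeDiscriminant ν) (0<ν : 0ℚ < ν) where

    Φα-pos : ∀ x → 0ℚ < Φ ν α x
    Φα-pos x = quadratic-pos (1ℚ + (α + β) * ν) (α * ν * (ν + 1ℚ)) x disc

    Φβ-pos : ∀ x → 0ℚ < Φ ν β x
    Φβ-pos x = subst (0ℚ <_) (sym (raise x α β ν))
      (+-pos (Φα-pos x) (*-pos (*-pos (p<q⇒0<q-p α<β) 0<ν) (+-pos 0<ν (positive⁻¹ 1ℚ))))
      where
      raise : ∀ x α β ν → x * x - (1ℚ + (α + β) * ν) * x + β * ν * (ν + 1ℚ)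
                        ≡ x * x - (1ℚ + (α + β) * ν) * x + α * ν * (ν + 1ℚ) + (β - α) * ν * (ν + 1ℚ)
      raise = solve-∀ ℚ-ring

    lowWeight-bounds : 0ℚ < α * ν - β × α * ν - β < ν - 1ℚ
    lowWeight-bounds =
        0<p*q⇒0<q 0<ν (subst (0ℚ <_) (at-1 α β ν) (Φα-pos 1ℚ))
      , 0<q-p⇒p<q (0<p*q⇒0<q 0<ν (subst (0ℚ <_) (at-ν α β ν) (Φβ-pos ν)))
      where
      at-1 : ∀ α β ν → 1ℚ * 1ℚ - (1ℚ + (α + β) * ν) * 1ℚ + α * ν * (ν + 1ℚ) ≡ ν * (α * ν - β)
      at-1 = solve-∀ ℚ-ring
      at-ν : ∀ α β ν → ν * ν - (1ℚ + (α + β) * ν) * ν + β * ν * (ν + 1ℚ) ≡ ν * (ν - 1ℚ - (α * ν - β))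
      at-ν = solve-∀ ℚ-ring

    highWeight-bounds : 0ℚ < β * ν - α × β * ν - α < ν - 1ℚ
    highWeight-bounds =
        0<p*q⇒0<q 0<ν (subst (0ℚ <_) (at-1 α β ν) (Φβ-pos 1ℚ))
      , 0<q-p⇒p<q (0<p*q⇒0<q 0<ν (subst (0ℚ <_) (at-ν α β ν) (Φα-pos ν)))
      where
      at-1 : ∀ α β ν → 1ℚ * 1ℚ - (1ℚ + (α + β) * ν) * 1ℚ + β * ν * (ν + 1ℚ) ≡ ν * (β * ν - α)
      at-1 = solve-∀ ℚ-ring
      at-ν : ∀ α β ν → ν * ν - (1ℚ + (α + β) * ν) * ν + α * ν * (ν + 1ℚ) ≡ ν * (ν - 1ℚ - (β * ν - α))
      at-ν = solve-∀ ℚ-ring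

  allLow : ∀ ν → TwoTypeWeights 0ℚ (1ℚ + ν) (densityDegree ν)
  allLow ν = twoTypeWeights β β α β∈ β∈ α∈ (balance β β ν) (balance β α ν)
    where
    balance : ∀ β γ ν → 0ℚ * β + (1ℚ + ν) * γ ≡ γ * ν + γ
    balance = solve-∀ ℚ-ring

  allHigh : ∀ ν → TwoTypeWeights (1ℚ + ν) 0ℚ (densityDegree ν)
  allHigh ν = twoTypeWeights β α α β∈ α∈ α∈ (balance α β ν) (balance α α ν)
    where
    balance : ∀ α γ ν → (1ℚ + ν) * γ + 0ℚ * α ≡ γ * ν + γ
    balance = solve-∀ ℚ-ring

  singleHigh : ∀ {ν} → NegativeDiscriminant ν → 0ℚ < ν → TwoTypeWeights 1ℚ ν (densityDegree ν)
  singleHigh {ν} disc 0<ν = twoTypeWeights β β q β∈ β∈ (÷-∈⟨0,1⟩ 0<ν-1 (α * ν - β) 0<αν-β αν-β<ν-1) (high β ν) low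
    where
    0<αν-β : 0ℚ < α * ν - β
    0<αν-β = proj₁ (lowWeight-bounds disc 0<ν)
    αν-β<ν-1 : α * ν - β < ν - 1ℚ
    αν-β<ν-1 = proj₂ (lowWeight-bounds disc 0<ν)
    0<ν-1 : 0ℚ < ν - 1ℚ
    0<ν-1 = <-trans 0<αν-β αν-β<ν-1
    instance
      ν-1≢0 : NonZero (ν - 1ℚ)
      ν-1≢0 = >-nonZero 0<ν-1
    q : ℚ
    q = (α * ν - β) ÷ (ν - 1ℚ)
    high : ∀ β ν → 1ℚ * β + ν * β ≡ β * ν + β
    high = solve-∀ ℚ-ring
    low : 1ℚ * β + ν * q ≡ α * ν + q
    low = begin
      1ℚ * β + ν * q                  ≡⟨ split β ν q ⟩
      β + q * (ν - 1ℚ) + q            ≡⟨ cong (λ z → β + z + q) (÷-*-cancel (α * ν - β) (ν - 1ℚ)) ⟩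
      β + (α * ν - β) + q             ≡⟨ merge α β ν q ⟩
      α * ν + q                       ∎
      where
      open ≡-Reasoning
      split : ∀ β ν q → 1ℚ * β + ν * q ≡ β + q * (ν - 1ℚ) + q
      split = solve-∀ ℚ-ring
      merge : ∀ α β ν q → β + (α * ν - β) + q ≡ α * ν + q
      merge = solve-∀ ℚ-ring

  singleLow : ∀ {ν} → NegativeDiscriminant ν → 0ℚ < ν → TwoTypeWeights ν 1ℚ (densityDegree ν)
  singleLow {ν} disc 0<ν = twoTypeWeights p α α (÷-∈⟨0,1⟩ 0<ν-1 (β * ν - α) 0<βν-α βν-α<ν-1) α∈ α∈ high (low α ν)
    where
    0<βν-α : 0ℚ < β * ν - α
    0<βν-α = proj₁ (highWeight-bounds disc 0<ν)
    βν-α<ν-1 : β * ν - α < ν - 1ℚ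
    βν-α<ν-1 = proj₂ (highWeight-bounds disc 0<ν)
    0<ν-1 : 0ℚ < ν - 1ℚ
    0<ν-1 = <-trans 0<βν-α βν-α<ν-1
    instance
      ν-1≢0 : NonZero (ν - 1ℚ)
      ν-1≢0 = >-nonZero 0<ν-1
    p : ℚ
    p = (β * ν - α) ÷ (ν - 1ℚ)
    low : ∀ α ν → ν * α + 1ℚ * α ≡ α * ν + α
    low = solve-∀ ℚ-ring
    high : ν * p + 1ℚ * α ≡ β * ν + p
    high = begin
      ν * p + 1ℚ * α                  ≡⟨ split α ν p ⟩
      α + p * (ν - 1ℚ) + p            ≡⟨ cong (λ z → α + z + p) (÷-*-cancel (β * ν - α) (ν - 1ℚ)) ⟩
      α + (β * ν - α) + p             ≡⟨ merge α β ν p ⟩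
      β * ν + p                       ∎
      where
      open ≡-Reasoning
      split : ∀ α ν p → ν * p + 1ℚ * α ≡ α + p * (ν - 1ℚ) + p
      split = solve-∀ ℚ-ring
      merge : ∀ α β ν p → α + (β * ν - α) + p ≡ β * ν + p
      merge = solve-∀ ℚ-ring

  severalOfEach : ∀ {A B} → 0ℚ < A → 0ℚ < B → NegativeDiscriminant (A + B + 1ℚ) →
    TwoTypeWeights (A + 1ℚ) (B + 1ℚ) (densityDegree (A + B + 1ℚ))
  severalOfEach {A} {B} 0<A 0<B disc =
    twoTypeWeights-bounded (densityDegree ν) 0<A 0<B (*-pos (proj₁ β∈) 0<ν) (*-pos 0<α 0<ν)
      (below-ν β<1) (below-ν (proj₂ α∈)) cross-high cross-low
    where
    ν : ℚ
    ν = A + B + 1ℚ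
    0<ν : 0ℚ < ν
    0<ν = +-pos (+-pos 0<A 0<B) (positive⁻¹ 1ℚ)
    below-ν : ∀ {γ} → γ < 1ℚ → γ * ν < ν
    below-ν {γ} γ<1 = subst (γ * ν <_) (*-identityˡ ν) (*-monoˡ-<′ ν 0<ν γ<1)
    cross-high : (β * ν - A) * (A + 1ℚ) < α * ν * (B + 1ℚ)
    cross-high = 0<q-p⇒p<q (subst (0ℚ <_) (at-A+1 α β A B) (Φα-pos disc 0<ν (A + 1ℚ)))
      where
      at-A+1 : ∀ α β A B →
        (A + 1ℚ) * (A + 1ℚ) - (1ℚ + (α + β) * (A + B + 1ℚ)) * (A + 1ℚ) + α * (A + B + 1ℚ) * (A + B + 1ℚ + 1ℚ)
        ≡ α * (A + B + 1ℚ) * (B + 1ℚ) - (β * (A + B + 1ℚ) - A) * (A + 1ℚ)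
      at-A+1 = solve-∀ ℚ-ring
    cross-low : (α * ν - B) * (B + 1ℚ) < β * ν * (A + 1ℚ)
    cross-low = 0<q-p⇒p<q (subst (0ℚ <_) (at-B+1 α β A B) (Φβ-pos disc 0<ν (B + 1ℚ)))
      where
      at-B+1 : ∀ α β A B →
        (B + 1ℚ) * (B + 1ℚ) - (1ℚ + (α + β) * (A + B + 1ℚ)) * (B + 1ℚ) + β * (A + B + 1ℚ) * (A + B + 1ℚ + 1ℚ)
        ≡ β * (A + B + 1ℚ) * (A + 1ℚ) - (α * (A + B + 1ℚ) - B) * (B + 1ℚ)
      at-B+1 = solve-∀ ℚ-ring

  negativeDiscriminant : ∀ {ν} → + 4 / 1 * (β - α) < ν * (+ 4 / 1 * α - (α + β) * (α + β)) →
    1ℚ ≤ ν * (β - α) → NegativeDiscriminant ν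
  negativeDiscriminant {ν} 4[β-α]<νc 1≤ν[β-α] = 0<q-p⇒p<q (subst (0ℚ <_) (sym (regroup α β ν))
    (+-pos-nonNeg (+-pos-nonNeg (+-pos (*-pos 0<ν (p<q⇒0<q-p 4[β-α]<νc)) (positive⁻¹ 1ℚ)) excess) excess))
    where
    0<ν : 0ℚ < ν
    0<ν = 0<p*q⇒0<q (p<q⇒0<q-p α<β) (subst (0ℚ <_) (*-comm ν (β - α)) (<-≤-trans (positive⁻¹ 1ℚ) 1≤ν[β-α]))
    excess : 0ℚ ≤ ν * (β - α) - 1ℚ
    excess = p≤q⇒0≤q-p 1≤ν[β-α]
    regroup : ∀ α β ν →
      + 4 / 1 * (α * ν * (ν + 1ℚ)) - (1ℚ + (α + β) * ν) * (1ℚ + (α + β) * ν)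
      ≡ ν * (ν * (+ 4 / 1 * α - (α + β) * (α + β)) - + 4 / 1 * (β - α)) + 1ℚ + (ν * (β - α) - 1ℚ) + (ν * (β - α) - 1ℚ)
    regroup = solve-∀ ℚ-ring

  densityWeights : ∀ {ν} → NegativeDiscriminant ν → ∀ K L → fromℕ K + fromℕ L ≡ 1ℚ + ν →
    TwoTypeWeights (fromℕ K) (fromℕ L) (densityDegree ν)
  densityWeights {ν} disc zero L K+L≡1+ν =
    retype refl (sym (trans (sym (+-identityˡ (fromℕ L))) K+L≡1+ν)) refl (allLow ν)
  densityWeights {ν} disc (suc K) zero K+L≡1+ν =
    retype (sym (trans (sym (+-identityʳ (fromℕ (suc K)))) K+L≡1+ν)) refl refl (allHigh ν)
  densityWeights {ν} disc 1 (suc L) K+L≡1+ν =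
    retype refl (sym L≡ν) refl (singleHigh disc (subst (0ℚ <_) L≡ν (fromℕ-pos L)))
    where
    L≡ν : fromℕ (suc L) ≡ ν
    L≡ν = +-cancelˡ-≡ 1ℚ (fromℕ (suc L)) ν K+L≡1+ν
  densityWeights {ν} disc (suc (suc K)) 1 K+L≡1+ν =
    retype (sym K≡ν) refl refl (singleLow disc (subst (0ℚ <_) K≡ν (fromℕ-pos (suc K))))
    where
    K≡ν : fromℕ (suc (suc K)) ≡ ν
    K≡ν = +-cancelʳ-≡ 1ℚ (fromℕ (suc (suc K))) ν (trans K+L≡1+ν (+-comm 1ℚ ν))
  densityWeights {ν} disc (suc (suc K)) (suc (suc L)) K+L≡1+ν =
    retype (sym K≡A+1) (sym L≡B+1) (cong densityDegree (sym ν≡A+B+1))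
      (severalOfEach (fromℕ-pos K) (fromℕ-pos L) (subst NegativeDiscriminant ν≡A+B+1 disc))
    where
    A B : ℚ
    A = fromℕ (suc K)
    B = fromℕ (suc L)
    K≡A+1 : fromℕ (suc (suc K)) ≡ A + 1ℚ
    K≡A+1 = trans (fromℕ-suc (suc K)) (+-comm 1ℚ A)
    L≡B+1 : fromℕ (suc (suc L)) ≡ B + 1ℚ
    L≡B+1 = trans (fromℕ-suc (suc L)) (+-comm 1ℚ B)
    shuffle : ∀ A B → A + 1ℚ + (B + 1ℚ) ≡ 1ℚ + (A + B + 1ℚ)
    shuffle = solve-∀ ℚ-ring
    ν≡A+B+1 : ν ≡ A + B + 1ℚ
    ν≡A+B+1 = +-cancelˡ-≡ 1ℚ ν (A + B + 1ℚ) (trans (sym K+L≡1+ν) (trans (cong₂ _+_ K≡A+1 L≡B+1) (shuffle A B)))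

interiorPoint : ∀ {n} (D : Fin n → ℤ) (y : Fin n → Fin n → ℚ) → Symmetric y → (∀ j k → y j k ∈⟨0,1⟩) →
  (∀ k → offDiagSum y k ≡ D k / 1) → InteriorPoint D y
interiorPoint D y y-sym y-∈ degrees =
  (y-sym , degrees , λ j k _ → <⇒≤ (proj₁ (y-∈ j k)) , <⇒≤ (proj₂ (y-∈ j k))) , λ j k _ → y-∈ j k

within-spread : ∀ {α β x y ν} → α < x → x < β → α < y → y < β → 0ℚ < ν → ν * (β - α) ≤ 1ℚ → x * ν < 1ℚ + y * ν
within-spread {α} {β} {x} {y} {ν} α<x x<β α<y y<β 0<ν ν[β-α]≤1 = 0<q-p⇒p<q (subst (0ℚ <_) (sym (regroup α β x y ν))
  (+-pos-nonNeg (*-pos 0<ν (+-pos (p<q⇒0<q-p x<β) (p<q⇒0<q-p α<y))) (p≤q⇒0≤q-p ν[β-α]≤1)))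
  where
  regroup : ∀ α β x y ν → 1ℚ + y * ν - x * ν ≡ ν * (β - x + (y - α)) + (1ℚ - ν * (β - α))
  regroup = solve-∀ ℚ-ring

module DegreeSequence {α β : ℚ} (0<α : 0ℚ < α) (α<β : α < β) (β<1 : β < 1ℚ)
  (N : ℕ) .{{_ : ℕ.NonZero N}} (D : Fin (suc N) → ℤ) (D-bounds : ∀ i → α < D i / N × D i / N < β) where

  open DensityWeights 0<α α<β β<1

  ν : ℚ
  ν = fromℕ N

  δ : Fin (suc N) → ℚ
  δ i = D i / N

  δν≡D : ∀ i → δ i * ν ≡ D i / 1
  δν≡D i = /-*-fromℕ (D i) N

  interiorPoint-if-narrow : ν * (β - α) ≤ 1ℚ → Σ (Fin (suc N) → Fin (suc N) → ℚ) (InteriorPoint D)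
  interiorPoint-if-narrow ν[β-α]≤1 = (λ _ _ → δ zero) , interiorPoint D _ (λ _ _ → refl) (λ _ _ → δ∈) degrees
    where
    δ∈ : δ zero ∈⟨0,1⟩
    δ∈ = <-trans 0<α (proj₁ (D-bounds zero)) , <-trans (proj₂ (D-bounds zero)) β<1
    close : ∀ i j → D i / 1 < 1ℚ + D j / 1
    close i j = subst₂ _<_ (δν≡D i) (cong (_+_ 1ℚ) (δν≡D j))
      (within-spread (proj₁ (D-bounds i)) (proj₂ (D-bounds i)) (proj₁ (D-bounds j)) (proj₂ (D-bounds j))
        (fromℕ-nonZero-pos N) ν[β-α]≤1)
    D-const : ∀ i j → D i ≡ D j
    D-const i j = ℤₚ.≤-antisym (/1-<-1+⇒≤ (close i j)) (/1-<-1+⇒≤ (close j i))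
    degrees : ∀ k → offDiagSum (λ _ _ → δ zero) k ≡ D k / 1
    degrees k = begin
      offDiagSum (λ _ _ → δ zero) k   ≡⟨ offDiagSum-const N (δ zero) k ⟩
      ν * δ zero                      ≡⟨ *-comm ν (δ zero) ⟩
      δ zero * ν                      ≡⟨ δν≡D zero ⟩
      D zero / 1                      ≡⟨ cong (_/ 1) (D-const zero k) ⟩
      D k / 1                         ∎
      where open ≡-Reasoning

  interiorPoint-if-negativeDiscriminant : NegativeDiscriminant ν → Σ (Fin (suc N) → Fin (suc N) → ℚ) (InteriorPoint D)
  interiorPoint-if-negativeDiscriminant disc = y , interiorPoint D y y-sym y-∈ degrees
    where
    0<β-α : 0ℚ < β - α
    0<β-α = p<q⇒0<q-p α<β
    instance
      β-α≢0 : NonZero (β - α)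
      β-α≢0 = >-nonZero 0<β-α
    θ : Vector ℚ (suc N)
    θ i = (δ i - α) ÷ (β - α)
    θ∈ : ∀ i → θ i ∈⟨0,1⟩
    θ∈ i = ÷-∈⟨0,1⟩ 0<β-α (δ i - α) (p<q⇒0<q-p (proj₁ (D-bounds i))) (+-monoˡ-< (- α) (proj₂ (D-bounds i)))
    counts : ∀ σ → fromℕ (count σ) + fromℕ (count (not ∘ σ)) ≡ 1ℚ + ν
    counts σ = trans (sym (fromℕ-+ (count σ) (count (not ∘ σ)))) (trans (cong fromℕ (count+count-not σ)) (fromℕ-suc N))
    mixture : Σ (Fin (suc N) → Fin (suc N) → ℚ) λ y → Symmetric y × (∀ j k → y j k ∈⟨0,1⟩)
      × (∀ k → offDiagSum y k ≡ θ k * (β * ν) + (1ℚ - θ k) * (α * ν))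
    mixture = mixtureOfTwoTypes θ θ∈ (densityDegree ν) (λ σ → densityWeights disc (count σ) (count (not ∘ σ)) (counts σ))
    y : Fin (suc N) → Fin (suc N) → ℚ
    y = proj₁ mixture
    y-sym : Symmetric y
    y-sym = proj₁ (proj₂ mixture)
    y-∈ : ∀ j k → y j k ∈⟨0,1⟩
    y-∈ = proj₁ (proj₂ (proj₂ mixture))
    degrees : ∀ k → offDiagSum y k ≡ D k / 1
    degrees k = begin
      offDiagSum y k                                  ≡⟨ proj₂ (proj₂ (proj₂ mixture)) k ⟩
      θ k * (β * ν) + (1ℚ - θ k) * (α * ν)            ≡⟨ interpolate α β ν (θ k) ⟩
      (α + θ k * (β - α)) * ν                         ≡⟨ cong (λ z → (α + z) * ν) (÷-*-cancel (δ k - α) (β - α)) ⟩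
      (α + (δ k - α)) * ν                             ≡⟨ cong (_* ν) (restore α (δ k)) ⟩
      δ k * ν                                         ≡⟨ δν≡D k ⟩
      D k / 1                                         ∎
      where
      open ≡-Reasoning
      interpolate : ∀ α β ν t → t * (β * ν) + (1ℚ - t) * (α * ν) ≡ (α + t * (β - α)) * ν
      interpolate = solve-∀ ℚ-ring
      restore : ∀ α δ → α + (δ - α) ≡ δ
      restore = solve-∀ ℚ-ring

lemma12p3 : (α β : ℚ) → 0ℚ < α → α < β → β < 1ℚ
    → (α + β) * (α + β) < (+ 4 / 1) * α
    → .{{_ : NonZero (α * (1ℚ - β))}}
    → .{{_ : NonZero ((+ 4 / 1) * α - (α + β) * (α + β))}}
    → (n : ℕ) → .{{_ : ℕ.NonZero (n ∸ 1)}}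
    → (D : Fin n → ℤ)
    → (∀ i → α < D i / (n ∸ 1) × D i / (n ∸ 1) < β)
    → ((β ÷ (α * (1ℚ - β))) ⊔ (((+ 4 / 1) * (β - α)) ÷ ((+ 4 / 1) * α - (α + β) * (α + β)))) + 1ℚ < + n / 1
    → Σ (Fin n → Fin n → ℚ) (λ y → InteriorPoint D y)
lemma12p3 α β 0<α α<β β<1 [α+β]²<4α zero D D-bounds n-bound =
  (λ ()) , ((λ ()) , (λ ()) , λ ()) , λ ()
lemma12p3 α β 0<α α<β β<1 [α+β]²<4α (suc N) D D-bounds n-bound with ≤-total (fromℕ N * (β - α)) 1ℚ
... | inj₁ narrow = interiorPoint-if-narrow narrow
  where open DegreeSequence 0<α α<β β<1 N D D-bounds
... | inj₂ wide   = interiorPoint-if-negativeDiscriminant (negativeDiscriminant 4[β-α]<νc wide)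
  where
  open DegreeSequence 0<α α<β β<1 N D D-bounds
  open DensityWeights 0<α α<β β<1
  c : ℚ
  c = + 4 / 1 * α - (α + β) * (α + β)
  -- Only the second term of the maximum is needed.
  X<ν : (+ 4 / 1 * (β - α)) ÷ c < ν
  X<ν = ≤-<-trans (p≤q⊔p (β ÷ (α * (1ℚ - β))) _) (+-cancelʳ-< 1ℚ (subst (_ <_) (trans (fromℕ-suc N) (+-comm 1ℚ ν)) n-bound))
  4[β-α]<νc : + 4 / 1 * (β - α) < ν * c
  4[β-α]<νc = ÷<⇒<* (p<q⇒0<q-p [α+β]²<4α) (+ 4 / 1 * (β - α)) X<ν
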